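{- Let $n\geqslant 1$ and $k\geqslant 1$ be integers with $\gcd(n,k)=1$. Then $$R_k(n)=\frac{n-1}{2}-\sum_{d\mid n,\ d\neq 1}\frac{\varphi(d)\,I(l_k(d))}{2\,l_k(d)}.$$
   Context: A set $A\subset \mathbb{Z}/n\mathbb{Z}$ is called $k$-free if for all $x\in A$, $kx\notin A$ (in particular an $x$ with $kx=x$ can never belong to a $k$-free set). $R_k(n)$ denotes the maximal cardinality of a $k$-free subset of $\mathbb{Z}/n\mathbb{Z}$. For an integer $d$ coprime to $k$, $l_k(d)$ is the multiplicative order of $k$ in $(\mathbb{Z}/d\mathbb{Z})^*$. $I$ is the indicator function of the odd integers ($I(t)=1$ if $t$ is odd, $0$ otherwise), and $\varphi$ is Euler's totient function. -}

module Defs where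

open import Data.Nat using (ℕ; zero; suc; _+_; _*_; _∸_; _^_; _%_; _≤_)
open import Data.Nat.Divisibility using (_∣_; _∣?_)
open import Data.Nat.Coprimality using (coprime?)
open import Data.List using (List; []; _∷_; length; filter; map; upTo; foldr)
open import Data.Fin using (Fin; toℕ)
open import Data.Fin.Subset using (Subset; _∈_; ∣_∣)
open import Data.Product using (Σ; _×_)
open import Data.Integer using (+_)
open import Relation.Binary.PropositionalEquality using (_≡_)
open import Relation.Nullary using (¬_; yes; no)
import Data.Rational as ℚ
open ℚ using (ℚ)

-- x ↦ k x in ℤ/nℤ: y represents k·x iff k·x ≡ y + q·n for some q
-- (y is a canonical representative, y < n)
MulIs : (n k : ℕ) → Fin n → Fin n → Set
MulIs n k x y = Σ ℕ λ q → k * toℕ x ≡ toℕ y + q * n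

KFree : (n k : ℕ) → Subset n → Set
KFree n k A = ∀ (x y : Fin n) → x ∈ A → MulIs n k x y → ¬ (y ∈ A)

IsRk : (k n m : ℕ) → Set
IsRk k n m =
  (Σ (Subset n) λ A → KFree n k A × ∣ A ∣ ≡ m)
  × (∀ (B : Subset n) → KFree n k B → ∣ B ∣ ≤ m)

φ : ℕ → ℕ
φ d = length (filter (λ t → coprime? t d) (map suc (upTo d)))

-- multiplicative order of k modulo d (k coprime to d, k ≥ 1):
-- the least l ≥ 1 with k^l ≡ 1 (mod d), i.e. d ∣ k^l - 1.
-- Searched among l = 1,…,d (the order is ≤ φ(d) ≤ d); returned as
-- suc of a predecessor so that it is visibly nonzero.
ordSearch : (k d : ℕ) → ℕ → ℕ → ℕ
ordSearch k d zero      i = i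
ordSearch k d (suc fuel) i with d ∣? (k ^ suc i ∸ 1)
... | yes _ = i
... | no  _ = ordSearch k d fuel (suc i)

ordPred : (k d : ℕ) → ℕ
ordPred k d = ordSearch k d d 0

ord : (k d : ℕ) → ℕ
ord k d = suc (ordPred k d)

I : ℕ → ℕ
I t = t % 2

divisorsNot1 : ℕ → List ℕ
divisorsNot1 n = filter (λ d → d ∣? n) (map (λ i → 2 + i) (upTo (n ∸ 1)))

term : (k d : ℕ) → ℚ
term k d = (+ (φ d * I (ord k d))) ℚ./ (2 * suc (ordPred k d))

sumℚ : List ℚ → ℚ
sumℚ = foldr ℚ._+_ ℚ.0ℚ

formula : (k n : ℕ) → ℚ
formula k n = ((+ (n ∸ 1)) ℚ./ 2) ℚ.- sumℚ (map (term k) (divisorsNot1 n))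

-- Multiplication by k is a permutation σ of ℤ/nℤ, and a set is k-free exactly when it contains
-- no pair x, σ x. On a cycle of σ of length l at most ⌊l/2⌋ points can be chosen, since no two
-- cyclically adjacent points may be, and every other point of the cycle attains ⌊l/2⌋; so R_k(n)
-- is the sum of ⌊l/2⌋ over the cycles. Spreading the contribution of a cycle evenly over its
-- points as ⌊l/2⌋/l = 1/2 - I(l)/(2l) turns this into a sum over x ∈ ℤ/nℤ. The cycle through x
-- has length l_k(d), where d = n/gcd(x, n) is the additive order of x, and exactly φ(d) residues
-- have additive order d; the divisor d = 1 contributes the 1/2 that turns n/2 into (n-1)/2.

module Submission where

open import Level using (0ℓ)
open import Algebra.Bundles using (CommutativeMonoid)
open import Data.Bool using (Bool; true; false; _∧_; _∨_; not; if_then_else_; T)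
import Data.Bool.Properties as Boolₚ
open import Data.Empty using (⊥; ⊥-elim)
open import Data.Fin as Fin using (Fin; toℕ; fromℕ<)
open import Data.Fin.Properties using (toℕ<n; toℕ-fromℕ<; toℕ-injective; pigeonhole; any?) renaming (_≟_ to _≟ᶠ_)
open import Data.Fin.Subset as Subset using (Subset; _∈_)
open import Data.Integer as ℤ using (+_)
open import Data.Integer.Properties using (pos-*; pos-+)
open import Data.List using (length; filter; map; applyUpTo; upTo)
open import Data.List.Properties using (map-upTo)
open import Data.Nat hiding (_/_)
import Data.Nat as ℕ
open import Data.Nat.Properties
open import Data.Nat.DivMod
  using (m≡m%n+[m/n]*n; m%n<n; m<n⇒m%n≡m; m%n%n≡m%n; [m+n]%n≡m%n; [m+kn]%n≡m%n; m*n%n≡0; %-distribˡ-*)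
open import Data.Nat.Divisibility
  using (_∣_; _∣?_; divides; quotient; 1∣_; ∣-refl; ∣-trans; ∣-antisym; ∣⇒≤; ∣1⇒≡1; n∣m*n; ∣m⇒∣m*n; ∣m+n∣m⇒∣n;
         *-monoˡ-∣; *-monoʳ-∣; *-cancelˡ-∣)
open import Data.Nat.GCD using (gcd; gcd[m,n]∣m; gcd[m,n]∣n; gcd-greatest; gcd-zeroˡ; gcd-identityˡ; c*gcd[m,n]≡gcd[cm,cn])
open import Data.Nat.Coprimality using (Coprime; coprime?; coprime-divisor; gcd≡1⇒coprime)
open import Data.Nat.Tactic.RingSolver using (solve-∀)
open import Data.Product using (Σ; _×_; _,_; proj₁; proj₂)
open import Data.Rational as ℚ using (ℚ; 0ℚ; _/_; ½; toℚᵘ)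
import Data.Rational.Properties as ℚₚ
import Data.Rational.Unnormalised as ℚᵘ
import Data.Rational.Unnormalised.Properties as ℚᵘₚ
open import Data.Sum using (_⊎_; inj₁; inj₂)
open import Data.Vec using ([]; _∷_; lookup; tabulate)
open import Data.Vec.Properties using ([]=⇒lookup; lookup⇒[]=; lookup∘tabulate)
open import Function using (_∘_)
open import Function.Bundles using (Equivalence; _⇔_; mk⇔)
import Function.Properties.Equivalence as ⇔
open import Relation.Binary.Definitions using (tri<; tri≈; tri>)
open import Relation.Binary.PropositionalEquality
open import Relation.Nullary using (¬_; Dec; does; yes; no)
open import Relation.Nullary.Decidable using (T?; dec-true; dec-false; does-⇔)

open import Defs

Disjoint : ∀ {n} → (Fin n → Bool) → (Fin n → Bool) → Set
Disjoint A B = ∀ x → T (A x) → T (B x) → ⊥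

infix  4 _⊆ᵇ_
infixr 6 _∪ᵇ_
infixr 7 _∩ᵇ_
infixl 6 _─ᵇ_

_⊆ᵇ_ : ∀ {n} → (Fin n → Bool) → (Fin n → Bool) → Set
A ⊆ᵇ B = ∀ x → T (A x) → T (B x)

_∪ᵇ_ _∩ᵇ_ _─ᵇ_ : ∀ {n} → (Fin n → Bool) → (Fin n → Bool) → Fin n → Bool
(A ∪ᵇ B) x = A x ∨ B x
(A ∩ᵇ B) x = A x ∧ B x
(A ─ᵇ B) x = A x ∧ not (B x)

T-ext : ∀ {a b} → (T a → T b) → (T b → T a) → a ≡ b
T-ext {false} {false} _ _ = refl
T-ext {false} {true}  _ b⇒a = ⊥-elim (b⇒a _)
T-ext {true}  {false} a⇒b _ = ⊥-elim (a⇒b _)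
T-ext {true}  {true}  _ _ = refl

T-not : ∀ {b} → T (not b) → T b → ⊥
T-not {true} ()

¬T⇒≡false : ∀ {b} → ¬ T b → b ≡ false
¬T⇒≡false {false} _  = refl
¬T⇒≡false {true}  ¬T = ⊥-elim (¬T _)

[_]ᵇ : Bool → ℕ
[ b ]ᵇ = if b then 1 else 0

[b]ᵇ≤1 : ∀ b → [ b ]ᵇ ≤ 1
[b]ᵇ≤1 true  = s≤s z≤n
[b]ᵇ≤1 false = z≤n

module FiniteSums (M : CommutativeMonoid 0ℓ 0ℓ) where
  open CommutativeMonoid M
    using (_≈_; ∙-congˡ; assoc; identityˡ; identityʳ)
    renaming ( Carrier to A; _∙_ to _⊕_; ε to 0#; setoid to ≈-setoid
             ; refl to ≈-refl; sym to ≈-sym; trans to ≈-trans; reflexive to ≈-reflexive)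
  open import Algebra.Properties.CommutativeMonoid.Sum M public
    using (sum; sum-cong-≗; sum-cong-≋; ∑-distrib-+; ∑-comm; sum-replicate-zero)
  open import Relation.Binary.Reasoning.Setoid ≈-setoid

  ∑< : ℕ → (ℕ → A) → A
  ∑< n f = sum {n} (f ∘ toℕ)

  ∑<-cong : ∀ n {f g : ℕ → A} → (∀ i → i < n → f i ≡ g i) → ∑< n f ≡ ∑< n g
  ∑<-cong n f≗g = sum-cong-≗ (λ i → f≗g (toℕ i) (toℕ<n i))

  ∑<-+ : ∀ a b f → ∑< (a + b) f ≈ ∑< a f ⊕ ∑< b (λ i → f (a + i))
  ∑<-+ zero    b f = ≈-sym (identityˡ _)
  ∑<-+ (suc a) b f = ≈-trans (∙-congˡ (∑<-+ a b (f ∘ suc))) (≈-sym (assoc _ _ _))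

  ∑<-last : ∀ n f → ∑< (suc n) f ≈ ∑< n f ⊕ f n
  ∑<-last zero    f = ≈-trans (identityʳ _) (≈-sym (identityˡ _))
  ∑<-last (suc n) f = ≈-trans (∙-congˡ (∑<-last n (f ∘ suc))) (≈-sym (assoc _ _ _))

  ∑<-* : ∀ d g f → ∑< (d * g) f ≈ ∑< d (λ t → ∑< g (λ r → f (t * g + r)))
  ∑<-* zero    g f = ≈-refl
  ∑<-* (suc d) g f = ≈-trans (∑<-+ g (d * g) f) (∙-congˡ (≈-trans (∑<-* d g (λ i → f (g + i)))
    (≈-reflexive (∑<-cong d (λ t _ → ∑<-cong g (λ r _ → cong f (sym (+-assoc g (t * g) r))))))))

  ∑∈ : ∀ {n} → (Fin n → Bool) → (Fin n → A) → A
  ∑∈ P f = sum (λ x → if P x then f x else 0#)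

  ∑∈-cong : ∀ {n} {P Q : Fin n → Bool} f → (∀ x → P x ≡ Q x) → ∑∈ P f ≡ ∑∈ Q f
  ∑∈-cong f P≗Q = sum-cong-≗ (λ x → cong (λ b → if b then f x else 0#) (P≗Q x))

  ∑∈-cong-on : ∀ {n} (P : Fin n → Bool) {f g} → (∀ x → T (P x) → f x ≡ g x) → ∑∈ P f ≡ ∑∈ P g
  ∑∈-cong-on P f≗g = sum-cong-≗ (λ x → lemma (P x) (f≗g x))
    where
    lemma : ∀ {u v} b → (T b → u ≡ v) → (if b then u else 0#) ≡ (if b then v else 0#)
    lemma true  u≡v = u≡v _
    lemma false _   = refl

  ∑∈-∅ : ∀ {n} {P : Fin n → Bool} f → (∀ x → P x ≡ false) → ∑∈ P f ≈ 0#
  ∑∈-∅ {n} f P≗∅ = ≈-trans (≈-reflexive (∑∈-cong f P≗∅)) (sum-replicate-zero n)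

  ∑∈-∪ : ∀ {n} {P Q : Fin n → Bool} f → Disjoint P Q → ∑∈ (P ∪ᵇ Q) f ≈ ∑∈ P f ⊕ ∑∈ Q f
  ∑∈-∪ {P = P} {Q} f disj = ≈-trans (sum-cong-≋ (λ x → split (P x) (Q x) (disj x)))
    (∑-distrib-+ (λ x → if P x then f x else 0#) (λ x → if Q x then f x else 0#))
    where
    split : ∀ {w} p q → (T p → T q → ⊥) →
      (if p ∨ q then w else 0#) ≈ (if p then w else 0#) ⊕ (if q then w else 0#)
    split true  true  p∧q = ⊥-elim (p∧q _ _)
    split true  false _   = ≈-sym (identityʳ _)
    split false _     _   = ≈-sym (identityˡ _)

  ∑∈-─ : ∀ {n} {P C : Fin n → Bool} f → C ⊆ᵇ P → ∑∈ P f ≈ ∑∈ (P ─ᵇ C) f ⊕ ∑∈ C f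
  ∑∈-─ {P = P} {C} f C⊆P = ≈-trans (≈-reflexive (∑∈-cong f (λ x → split (P x) (C x) (C⊆P x))))
    (∑∈-∪ f (λ x → exclusive (P x) (C x)))
    where
    split : ∀ p c → (T c → T p) → p ≡ (p ∧ not c) ∨ c
    split true  true  _   = refl
    split true  false _   = refl
    split false true  c⇒p = ⊥-elim (c⇒p _)
    split false false _   = refl
    exclusive : ∀ p c → T (p ∧ not c) → T c → ⊥
    exclusive true true () _

  ∑∈-∧-≟ : ∀ {n} (B : Fin n → Bool) (c : Fin n) f →
           ∑∈ (λ x → B x ∧ does (c ≟ᶠ x)) f ≈ (if B c then f c else 0#)
  ∑∈-∧-≟ {suc n} B Fin.zero f = begin
    (if B Fin.zero ∧ true then f Fin.zero else 0#) ⊕ ∑∈ (λ x → B (Fin.suc x) ∧ false) (f ∘ Fin.suc)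
      ≈⟨ ∙-congˡ (∑∈-∅ (f ∘ Fin.suc) (λ x → Boolₚ.∧-zeroʳ (B (Fin.suc x)))) ⟩
    (if B Fin.zero ∧ true then f Fin.zero else 0#) ⊕ 0#
      ≈⟨ identityʳ _ ⟩
    (if B Fin.zero ∧ true then f Fin.zero else 0#)
      ≡⟨ cong (λ b → if b then f Fin.zero else 0#) (Boolₚ.∧-identityʳ (B Fin.zero)) ⟩
    (if B Fin.zero then f Fin.zero else 0#) ∎
  ∑∈-∧-≟ {suc n} B (Fin.suc c) f = begin
    (if B Fin.zero ∧ false then f Fin.zero else 0#) ⊕ rest
      ≡⟨ cong (λ b → (if b then f Fin.zero else 0#) ⊕ rest) (Boolₚ.∧-zeroʳ (B Fin.zero)) ⟩
    0# ⊕ rest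
      ≈⟨ identityˡ rest ⟩
    rest
      ≈⟨ ∑∈-∧-≟ (B ∘ Fin.suc) c (f ∘ Fin.suc) ⟩
    (if B (Fin.suc c) then f (Fin.suc c) else 0#) ∎
    where
    rest : A
    rest = ∑∈ (λ x → B (Fin.suc x) ∧ does (c ≟ᶠ x)) (f ∘ Fin.suc)

module ℕΣ = FiniteSums +-0-commutativeMonoid
module ℚΣ = FiniteSums ℚₚ.+-0-commutativeMonoid
open ℕΣ using (∑<; ∑<-cong; ∑<-last; ∑<-*)

count : ∀ {n} → (Fin n → Bool) → ℕ
count P = ℕΣ.∑∈ P (λ _ → 1)

∑<-ones : ∀ l → ∑< l (λ _ → 1) ≡ l
∑<-ones zero    = refl
∑<-ones (suc l) = cong suc (∑<-ones l)

image : ∀ {n} → (ℕ → Fin n) → ℕ → Fin n → Bool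
image f zero    x = false
image f (suc l) x = image f l x ∨ does (f l ≟ᶠ x)

image-sound : ∀ {n} (f : ℕ → Fin n) l x → T (image f l x) → Σ ℕ λ i → i < l × f i ≡ x
image-sound f (suc l) x x∈ with Equivalence.to Boolₚ.T-∨ x∈
... | inj₁ x∈f[l] = let i , i<l , fi≡x = image-sound f l x x∈f[l] in i , m<n⇒m<1+n i<l , fi≡x
... | inj₂ fl≟x with f l ≟ᶠ x
...   | yes fl≡x = l , n<1+n l , fl≡x

image-complete : ∀ {n} (f : ℕ → Fin n) {i l} → i < l → T (image f l (f i))
image-complete f {i} {suc l} i<1+l = Equivalence.from Boolₚ.T-∨ (lemma (m≤n⇒m<n∨m≡n (≤-pred i<1+l)))
  where
  lemma : i < l ⊎ i ≡ l → T (image f l (f i)) ⊎ T (does (f l ≟ᶠ f i))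
  lemma (inj₁ i<l)  = inj₁ (image-complete f i<l)
  lemma (inj₂ refl) with f i ≟ᶠ f i
  ... | yes _     = inj₂ _
  ... | no  fi≢fi = ⊥-elim (fi≢fi refl)

InjectiveBelow : ∀ {n} → ℕ → (ℕ → Fin n) → Set
InjectiveBelow l f = ∀ {i j} → i < l → j < l → f i ≡ f j → i ≡ j

count-∩-image : ∀ {n} (B : Fin n → Bool) (f : ℕ → Fin n) l → InjectiveBelow l f →
  count (B ∩ᵇ image f l) ≡ ∑< l (λ i → [ B (f i) ]ᵇ)
count-∩-image B f zero    _     = ℕΣ.∑∈-∅ _ (λ x → Boolₚ.∧-zeroʳ (B x))
count-∩-image B f (suc l) f-inj = begin
  count (λ x → B x ∧ (image f l x ∨ does (f l ≟ᶠ x)))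
    ≡⟨ ℕΣ.∑∈-cong _ (λ x → Boolₚ.∧-distribˡ-∨ (B x) _ _) ⟩
  count (λ x → (B x ∧ image f l x) ∨ (B x ∧ does (f l ≟ᶠ x)))
    ≡⟨ ℕΣ.∑∈-∪ _ disjoint ⟩
  count (λ x → B x ∧ image f l x) + count (λ x → B x ∧ does (f l ≟ᶠ x))
    ≡⟨ cong₂ _+_ (count-∩-image B f l (λ i<l j<l → f-inj (m<n⇒m<1+n i<l) (m<n⇒m<1+n j<l)))
                 (ℕΣ.∑∈-∧-≟ B (f l) _) ⟩
  ∑< l (λ i → [ B (f i) ]ᵇ) + [ B (f l) ]ᵇ
    ≡⟨ sym (∑<-last l (λ i → [ B (f i) ]ᵇ)) ⟩
  ∑< (suc l) (λ i → [ B (f i) ]ᵇ) ∎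
  where
  open ≡-Reasoning
  disjoint : Disjoint (B ∩ᵇ image f l) (λ x → B x ∧ does (f l ≟ᶠ x))
  disjoint x B∧fi≡x B∧fl≡x with f l ≟ᶠ x
  ... | yes fl≡x = let i , i<l , fi≡x = image-sound f l x (proj₂ (Equivalence.to Boolₚ.T-∧ B∧fi≡x))
                   in <⇒≢ i<l (f-inj (m<n⇒m<1+n i<l) (n<1+n l) (trans fi≡x (sym fl≡x)))
  ... | no _     = proj₂ (Equivalence.to Boolₚ.T-∧ B∧fl≡x)

toℚ : ℕ → ℚ
toℚ a = + a / 1

private
  _÷1+_ : ℕ → ℕ → ℚᵘ.ℚᵘ
  a ÷1+ b = ℚᵘ.mkℚᵘ (+ a) b

  toℚᵘ-/ : ∀ a b → toℚᵘ (+ a / suc b) ℚᵘ.≃ a ÷1+ b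
  toℚᵘ-/ a b = ℚₚ.toℚᵘ-fromℚᵘ (a ÷1+ b)

  ÷1+-≃ : ∀ a b c d → a * suc d ≡ c * suc b → a ÷1+ b ℚᵘ.≃ c ÷1+ d
  ÷1+-≃ a b c d e = ℚᵘ.*≡* (trans (sym (pos-* a (suc d))) (trans (cong +_ e) (pos-* c (suc b))))

  ÷1+-+ : ∀ a b c d → a ÷1+ b ℚᵘ.+ c ÷1+ d ℚᵘ.≃ (a * suc d + c * suc b) ÷1+ (d + b * suc d)
  ÷1+-+ a b c d = ℚᵘ.*≡* (cong (ℤ._* + suc (d + b * suc d))
     (trans (cong₂ ℤ._+_ (sym (pos-* a (suc d))) (sym (pos-* c (suc b)))) (sym (pos-+ (a * suc d) (c * suc b)))))

  ÷1+-* : ∀ a b c d → a ÷1+ b ℚᵘ.* c ÷1+ d ℚᵘ.≃ (a * c) ÷1+ (d + b * suc d)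
  ÷1+-* a b c d = ℚᵘ.*≡* (cong (ℤ._* + suc (d + b * suc d)) (sym (pos-* a c)))

  /-+ : ∀ a b c d → + a / suc b ℚ.+ + c / suc d ≡ + (a * suc d + c * suc b) / suc (d + b * suc d)
  /-+ a b c d = ℚₚ.toℚᵘ-injective (begin
    toℚᵘ (+ a / suc b ℚ.+ + c / suc d)              ≈⟨ ℚₚ.toℚᵘ-homo-+ (+ a / suc b) (+ c / suc d) ⟩
    toℚᵘ (+ a / suc b) ℚᵘ.+ toℚᵘ (+ c / suc d)       ≈⟨ ℚᵘₚ.+-cong (toℚᵘ-/ a b) (toℚᵘ-/ c d) ⟩
    a ÷1+ b ℚᵘ.+ c ÷1+ d                             ≈⟨ ÷1+-+ a b c d ⟩
    (a * suc d + c * suc b) ÷1+ (d + b * suc d) ≈⟨ ℚᵘₚ.≃-sym (toℚᵘ-/ _ (d + b * suc d)) ⟩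
    toℚᵘ (+ (a * suc d + c * suc b) / suc (d + b * suc d)) ∎)
    where open ℚᵘₚ.≃-Reasoning

  /-* : ∀ a b c d → + a / suc b ℚ.* (+ c / suc d) ≡ + (a * c) / suc (d + b * suc d)
  /-* a b c d = ℚₚ.toℚᵘ-injective (begin
    toℚᵘ (+ a / suc b ℚ.* (+ c / suc d))            ≈⟨ ℚₚ.toℚᵘ-homo-* (+ a / suc b) (+ c / suc d) ⟩
    toℚᵘ (+ a / suc b) ℚᵘ.* toℚᵘ (+ c / suc d)       ≈⟨ ℚᵘₚ.*-cong (toℚᵘ-/ a b) (toℚᵘ-/ c d) ⟩
    a ÷1+ b ℚᵘ.* c ÷1+ d                             ≈⟨ ÷1+-* a b c d ⟩
    (a * c) ÷1+ (d + b * suc d)                ≈⟨ ℚᵘₚ.≃-sym (toℚᵘ-/ (a * c) (d + b * suc d)) ⟩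
    toℚᵘ (+ (a * c) / suc (d + b * suc d))     ∎)
    where open ℚᵘₚ.≃-Reasoning

  /-≡ : ∀ a b c d → a * suc d ≡ c * suc b → + a / suc b ≡ + c / suc d
  /-≡ a b c d e = ℚₚ.toℚᵘ-injective (ℚᵘₚ.≃-trans (toℚᵘ-/ a b)
    (ℚᵘₚ.≃-trans (÷1+-≃ a b c d e) (ℚᵘₚ.≃-sym (toℚᵘ-/ c d))))

toℚ-+ : ∀ a b → toℚ (a + b) ≡ toℚ a ℚ.+ toℚ b
toℚ-+ a b = sym (trans (/-+ a 0 b 0) (/-≡ (a * 1 + b * 1) (0 + 0 * 1) (a + b) 0 (lemma a b)))
  where
  lemma : ∀ a b → (a * 1 + b * 1) * 1 ≡ (a + b) * suc (0 + 0 * 1)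
  lemma = solve-∀

toℚ-suc-* : ∀ m p → toℚ (suc m) ℚ.* p ≡ p ℚ.+ toℚ m ℚ.* p
toℚ-suc-* m p = trans (cong (ℚ._* p) (toℚ-+ 1 m))
  (trans (ℚₚ.*-distribʳ-+ p (toℚ 1) (toℚ m)) (cong (ℚ._+ toℚ m ℚ.* p) (ℚₚ.*-identityˡ p)))

toℚ-*-/ : ∀ a l → toℚ (suc l) ℚ.* (+ a / suc l) ≡ toℚ a
toℚ-*-/ a l = trans (/-* (suc l) 0 a l) (/-≡ (suc l * a) (l + 0 * suc l) a 0 (lemma a l))
  where
  lemma : ∀ a l → suc l * a * 1 ≡ a * suc (l + 0 * suc l)
  lemma = solve-∀

/-*-numerator : ∀ a c d .{{_ : NonZero d}} → + (a * c) / d ≡ toℚ a ℚ.* (+ c / d)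
/-*-numerator a c (suc d) = sym (trans (/-* a 0 c d) (/-≡ (a * c) (d + 0 * suc d) (a * c) d (lemma a c d)))
  where
  lemma : ∀ a c d → a * c * suc d ≡ a * c * suc (d + 0 * suc d)
  lemma = solve-∀

n/2+½≡[1+n]*½ : ∀ n → + n / 2 ℚ.+ ½ ≡ toℚ (suc n) ℚ.* ½
n/2+½≡[1+n]*½ n = trans (/-+ n 1 1 1)
  (trans (/-≡ (n * 2 + 1 * 2) (1 + 1 * 2) (suc n * 1) (1 + 0 * 2) (lemma n)) (sym (/-* (suc n) 0 1 1)))
  where
  lemma : ∀ n → (n * 2 + 1 * 2) * suc (1 + 0 * 2) ≡ suc n * 1 * suc (1 + 1 * 2)
  lemma = solve-∀

h/o+i/2o≡½ : ∀ h i o → h * 2 + i ≡ suc o → + h / suc o ℚ.+ + i / (2 * suc o) ≡ ½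
h/o+i/2o≡½ h i o e = trans (/-+ h o i d) (/-≡ (h * suc d + i * suc o) (d + o * suc d) 1 1
  (subst (λ l → (h * (2 * l) + i * l) * 2 ≡ 1 * (l * (2 * l))) e (lemma h i)))
  where
  d : ℕ
  d = o + suc (o + 0)
  lemma : ∀ h i → (h * (2 * (h * 2 + i)) + i * (h * 2 + i)) * 2
                ≡ 1 * ((h * 2 + i) * (2 * (h * 2 + i)))
  lemma = solve-∀

p+q≡r⇒p≡r-q : ∀ {p q r} → p ℚ.+ q ≡ r → p ≡ r ℚ.- q
p+q≡r⇒p≡r-q {p} {q} refl = begin
  p                        ≡⟨ sym (ℚₚ.+-identityʳ p) ⟩
  p ℚ.+ 0ℚ                 ≡⟨ cong (p ℚ.+_) (sym (ℚₚ.+-inverseʳ q)) ⟩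
  p ℚ.+ (q ℚ.- q)          ≡⟨ sym (ℚₚ.+-assoc p q (ℚ.- q)) ⟩
  p ℚ.+ q ℚ.- q            ∎
  where open ≡-Reasoning

p+[q+r]≡s+q⇒p≡s-r : ∀ {p q r s} → p ℚ.+ (q ℚ.+ r) ≡ s ℚ.+ q → p ≡ s ℚ.- r
p+[q+r]≡s+q⇒p≡s-r {p} {q} {r} {s} e = p+q≡r⇒p≡r-q (begin
  p ℚ.+ r                    ≡⟨ p+q≡r⇒p≡r-q refl ⟩
  p ℚ.+ r ℚ.+ q ℚ.- q        ≡⟨ cong (ℚ._- q) (trans (ℚₚ.+-assoc p r q) (cong (p ℚ.+_) (ℚₚ.+-comm r q))) ⟩
  p ℚ.+ (q ℚ.+ r) ℚ.- q      ≡⟨ cong (ℚ._- q) e ⟩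
  s ℚ.+ q ℚ.- q              ≡⟨ sym (p+q≡r⇒p≡r-q refl) ⟩
  s                          ∎)
  where open ≡-Reasoning

∑∈-const : ∀ {n} (P : Fin n → Bool) p → ℚΣ.∑∈ P (λ _ → p) ≡ toℚ (count P) ℚ.* p
∑∈-const {zero}  P p = sym (ℚₚ.*-zeroˡ p)
∑∈-const {suc n} P p with P Fin.zero
... | true  = trans (cong (p ℚ.+_) (∑∈-const (P ∘ Fin.suc) p)) (sym (toℚ-suc-* (count (P ∘ Fin.suc)) p))
... | false = trans (ℚₚ.+-identityˡ _) (∑∈-const (P ∘ Fin.suc) p)

⌊n/2⌋*2+n%2≡n : ∀ n → ⌊ n /2⌋ * 2 + n % 2 ≡ n
⌊n/2⌋*2+n%2≡n zero          = refl
⌊n/2⌋*2+n%2≡n (suc zero)    = refl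
⌊n/2⌋*2+n%2≡n (suc (suc n)) = cong (λ m → 2 + m) (trans
  (cong (λ r → ⌊ n /2⌋ * 2 + r) (trans (cong (_% 2) (+-comm 2 n)) ([m+n]%n≡m%n n 2)))
  (⌊n/2⌋*2+n%2≡n n))

halfRatio : ℕ → ℚ
halfRatio zero    = 0ℚ
halfRatio (suc l) = + ⌊ suc l /2⌋ / suc l

toℚ-*-halfRatio : ∀ l → .{{NonZero l}} → toℚ l ℚ.* halfRatio l ≡ toℚ ⌊ l /2⌋
toℚ-*-halfRatio (suc l) = toℚ-*-/ ⌊ suc l /2⌋ l

-- Independent sets on a cycle

NoTwoAdjacent : ℕ → (ℕ → Bool) → Set
NoTwoAdjacent m b = ∀ i → suc i < m → T (b i) → T (b (suc i)) → ⊥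

noTwoAdjacent-bound : ∀ m b → NoTwoAdjacent m b → ∑< m (λ i → [ b i ]ᵇ) ≤ ⌈ m /2⌉
noTwoAdjacent-bound zero          b _ = z≤n
noTwoAdjacent-bound (suc zero)    b _ = +-monoˡ-≤ 0 ([b]ᵇ≤1 (b 0))
noTwoAdjacent-bound (suc (suc m)) b adj =
  subst (_≤ suc ⌈ m /2⌉) (+-assoc [ b 0 ]ᵇ [ b 1 ]ᵇ _)
    (+-mono-≤ (pair (b 0) (b 1) (adj 0 (s≤s (s≤s z≤n))))
              (noTwoAdjacent-bound m (b ∘ suc ∘ suc) (λ i i<m → adj (suc (suc i)) (s≤s (s≤s i<m)))))
  where
  pair : ∀ x y → (T x → T y → ⊥) → [ x ]ᵇ + [ y ]ᵇ ≤ 1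
  pair true  true  x∧y = ⊥-elim (x∧y _ _)
  pair true  false _   = s≤s z≤n
  pair false y     _   = [b]ᵇ≤1 y

noTwoCyclicallyAdjacent-bound : ∀ l b → NoTwoAdjacent (suc l) b → (T (b l) → T (b 0) → ⊥) →
  ∑< (suc l) (λ i → [ b i ]ᵇ) ≤ ⌊ suc l /2⌋
noTwoCyclicallyAdjacent-bound l b adj wrap with b l in bl
... | false = begin
  ∑< (suc l) (λ i → [ b i ]ᵇ)      ≡⟨ ∑<-last l (λ i → [ b i ]ᵇ) ⟩
  ∑< l (λ i → [ b i ]ᵇ) + [ b l ]ᵇ ≡⟨ cong (λ x → ∑< l (λ i → [ b i ]ᵇ) + [ x ]ᵇ) bl ⟩
  ∑< l (λ i → [ b i ]ᵇ) + 0        ≡⟨ +-identityʳ _ ⟩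
  ∑< l (λ i → [ b i ]ᵇ)            ≤⟨ noTwoAdjacent-bound l b (λ i i<l → adj i (m<n⇒m<1+n i<l)) ⟩
  ⌈ l /2⌉                           ∎
  where open ≤-Reasoning
... | true with b 0
...   | true  = ⊥-elim (wrap _ _)
...   | false = noTwoAdjacent-bound l (b ∘ suc) (λ i i<l → adj (suc i) (s≤s i<l))

j<⌊l/2⌋⇒1+2j<l : ∀ {j l} → j < ⌊ l /2⌋ → suc (j * 2) < l
j<⌊l/2⌋⇒1+2j<l {j} {l} j<l/2 =
  ≤-trans (*-monoˡ-≤ 2 j<l/2) (subst (⌊ l /2⌋ * 2 ≤_) (⌊n/2⌋*2+n%2≡n l) (m≤m+n _ (l % 2)))

odd≢even : ∀ i j → suc (i * 2) ≢ j * 2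
odd≢even i j e = 1+n≢0 (trans (sym ([m+kn]%n≡m%n 1 i 2)) (trans (cong (_% 2) e) (m*n%n≡0 j 2)))

-- Maximal free sets of an injection of Fin n

module Orbits {n} (σ : Fin n → Fin n) (σ-injective : ∀ {x y} → σ x ≡ σ y → x ≡ y) where

  σ^ : ℕ → Fin n → Fin n
  σ^ zero    x = x
  σ^ (suc i) x = σ (σ^ i x)

  σ^-injective : ∀ i {x y} → σ^ i x ≡ σ^ i y → x ≡ y
  σ^-injective zero    e = e
  σ^-injective (suc i) e = σ^-injective i (σ-injective e)

  σ^-+ : ∀ i j x → σ^ (i + j) x ≡ σ^ i (σ^ j x)
  σ^-+ zero    j x = refl
  σ^-+ (suc i) j x = cong σ (σ^-+ i j x)

  σ^-suc : ∀ i x → σ^ (suc i) x ≡ σ^ i (σ x)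
  σ^-suc i x = trans (cong (λ k → σ^ k x) (+-comm 1 i)) (σ^-+ i 1 x)

  σ^-∸ : ∀ {i j} x → i ≤ j → σ^ i x ≡ σ^ j x → σ^ (j ∸ i) x ≡ x
  σ^-∸ {i} {j} x i≤j e = σ^-injective i (sym (begin
    σ^ i x                ≡⟨ e ⟩
    σ^ j x                ≡⟨ cong (λ k → σ^ k x) (sym (m+[n∸m]≡n i≤j)) ⟩
    σ^ (i + (j ∸ i)) x    ≡⟨ σ^-+ i (j ∸ i) x ⟩
    σ^ i (σ^ (j ∸ i) x)   ∎))
    where open ≡-Reasoning

  σ^-returns : ∀ x → Σ ℕ λ p → 1 ≤ p × p ≤ n × σ^ p x ≡ x
  σ^-returns x with i , j , i<j , e ← pigeonhole (n<1+n n) (λ (i : Fin (suc n)) → σ^ (toℕ i) x) =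
    toℕ j ∸ toℕ i , m<n⇒0<n∸m i<j , ≤-trans (m∸n≤m (toℕ j) (toℕ i)) (≤-pred (toℕ<n j)) ,
    σ^-∸ x (<⇒≤ i<j) e

  IsPeriod : Fin n → ℕ → Set
  IsPeriod x p = 1 ≤ p × σ^ p x ≡ x × (∀ i → 1 ≤ i → i < p → σ^ i x ≢ x)

  IsPeriod-unique : ∀ {x p q} → IsPeriod x p → IsPeriod x q → p ≡ q
  IsPeriod-unique {p = p} {q} (1≤p , σ^p , p-least) (1≤q , σ^q , q-least) with <-cmp p q
  ... | tri< p<q _ _ = ⊥-elim (q-least p 1≤p p<q σ^p)
  ... | tri≈ _ p≡q _ = p≡q
  ... | tri> _ _ q<p = ⊥-elim (p-least q 1≤q q<p σ^q)

  IsPeriod-σ : ∀ {x p} → IsPeriod x p → IsPeriod (σ x) p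
  IsPeriod-σ {x} {p} (1≤p , σ^p , p-least) =
    1≤p , trans (sym (σ^-suc p x)) (cong σ σ^p) ,
    λ i 1≤i i<p e → p-least i 1≤i i<p (σ-injective (trans (σ^-suc i x) e))

  IsPeriod⇒injectiveBelow : ∀ {x p} → IsPeriod x p → InjectiveBelow p (λ i → σ^ i x)
  IsPeriod⇒injectiveBelow {x} {p} (_ , _ , p-least) {i} {j} i<p j<p e with <-cmp i j
  ... | tri< i<j _ _ = ⊥-elim (p-least (j ∸ i) (m<n⇒0<n∸m i<j) (≤-<-trans (m∸n≤m j i) j<p)
                                       (σ^-∸ x (<⇒≤ i<j) e))
  ... | tri≈ _ i≡j _ = i≡j
  ... | tri> _ _ j<i = ⊥-elim (p-least (i ∸ j) (m<n⇒0<n∸m j<i) (≤-<-trans (m∸n≤m i j) i<p)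
                                       (σ^-∸ x (<⇒≤ j<i) (sym e)))

module MaxFreeSets {n} (σ : Fin n → Fin n) (σ-injective : ∀ {x y} → σ x ≡ σ y → x ≡ y)
  (L : Fin n → ℕ) (L-period : ∀ x → Orbits.IsPeriod σ σ-injective x (L x)) where

  open Orbits σ σ-injective

  Free : (Fin n → Bool) → Set
  Free A = Disjoint A (A ∘ σ)

  Invariant : (Fin n → Bool) → Set
  Invariant P = ∀ x → P (σ x) ≡ P x

  weight : (Fin n → Bool) → ℚ
  weight P = ℚΣ.∑∈ P (halfRatio ∘ L)

  HasMaxFree : (Fin n → Bool) → Set
  IsMaxFree : (Fin n → Bool) → ℕ → Set
  IsMaxFree P m = (Σ (Fin n → Bool) λ A → Free A × A ⊆ᵇ P × count A ≡ m)
                × (∀ B → Free B → B ⊆ᵇ P → count B ≤ m)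

  HasMaxFree P = Σ ℕ λ m → IsMaxFree P m × toℚ m ≡ weight P

  Free-⊆ : ∀ {A B} → A ⊆ᵇ B → Free B → Free A
  Free-⊆ A⊆B B-free x Ax Aσx = B-free x (A⊆B x Ax) (A⊆B (σ x) Aσx)

  L-σ^ : ∀ i x → L (σ^ i x) ≡ L x
  L-σ^ zero    x = refl
  L-σ^ (suc i) x = trans (IsPeriod-unique (L-period (σ (σ^ i x))) (IsPeriod-σ (L-period (σ^ i x)))) (L-σ^ i x)

  module Orbit (x₀ : Fin n) where

    l : ℕ
    l = L x₀

    1≤l : 1 ≤ l
    1≤l = proj₁ (L-period x₀)

    σ^l : σ^ l x₀ ≡ x₀
    σ^l = proj₁ (proj₂ (L-period x₀))

    instance
      l≢0 : NonZero l
      l≢0 = >-nonZero 1≤l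

    orbit : Fin n → Bool
    orbit = image (λ i → σ^ i x₀) l

    σ^-reduce : ∀ i → Σ ℕ λ j → j < l × σ^ i x₀ ≡ σ^ j x₀
    σ^-reduce zero    = 0 , 1≤l , refl
    σ^-reduce (suc i) with σ^-reduce i
    ... | j , j<l , e with m≤n⇒m<n∨m≡n j<l
    ...   | inj₁ 1+j<l = suc j , 1+j<l , cong σ e
    ...   | inj₂ 1+j≡l = 0 , 1≤l , trans (cong σ e) (trans (cong (λ k → σ^ k x₀) 1+j≡l) σ^l)

    σ^∈orbit : ∀ i → T (orbit (σ^ i x₀))
    σ^∈orbit i with j , j<l , e ← σ^-reduce i = subst (T ∘ orbit) (sym e) (image-complete _ j<l)

    orbit-σ : Invariant orbit
    orbit-σ x = T-ext backward forward
      where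
      forward : T (orbit x) → T (orbit (σ x))
      forward x∈ with i , _ , refl ← image-sound _ l x x∈ = σ^∈orbit (suc i)
      backward : T (orbit (σ x)) → T (orbit x)
      backward σx∈ with i , _ , e ← image-sound _ l (σ x) σx∈ =
        subst (T ∘ orbit) (σ-injective (begin
          σ^ (suc (i + pred l)) x₀ ≡⟨ cong (λ k → σ^ k x₀) (sym (+-suc i (pred l))) ⟩
          σ^ (i + suc (pred l)) x₀ ≡⟨ cong (λ k → σ^ (i + k) x₀) (suc-pred l) ⟩
          σ^ (i + l) x₀            ≡⟨ σ^-+ i l x₀ ⟩
          σ^ i (σ^ l x₀)           ≡⟨ cong (σ^ i) σ^l ⟩
          σ^ i x₀                  ≡⟨ e ⟩
          σ x                      ∎)) (σ^∈orbit (i + pred l))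
        where open ≡-Reasoning

    orbit-injective : InjectiveBelow l (λ i → σ^ i x₀)
    orbit-injective = IsPeriod⇒injectiveBelow (L-period x₀)

    count-∩-orbit : ∀ B → count (B ∩ᵇ orbit) ≡ ∑< l (λ i → [ B (σ^ i x₀) ]ᵇ)
    count-∩-orbit B = count-∩-image B _ l orbit-injective

    count-orbit : count orbit ≡ l
    count-orbit = trans (count-∩-orbit (λ _ → true)) (∑<-ones l)

    orbit⊆ : ∀ {P} → Invariant P → T (P x₀) → orbit ⊆ᵇ P
    orbit⊆ {P} inv Px₀ x x∈ with i , _ , refl ← image-sound _ l x x∈ = subst T (sym (P-σ^ i)) Px₀
      where
      P-σ^ : ∀ i → P (σ^ i x₀) ≡ P x₀
      P-σ^ zero    = refl
      P-σ^ (suc i) = trans (inv (σ^ i x₀)) (P-σ^ i)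

    weight-orbit : weight orbit ≡ toℚ ⌊ l /2⌋
    weight-orbit = begin
      ℚΣ.∑∈ orbit (halfRatio ∘ L)         ≡⟨ ℚΣ.∑∈-cong-on orbit (λ x x∈ → cong halfRatio (L-orbit x x∈)) ⟩
      ℚΣ.∑∈ orbit (λ _ → halfRatio l)     ≡⟨ ∑∈-const orbit (halfRatio l) ⟩
      toℚ (count orbit) ℚ.* halfRatio l   ≡⟨ cong (λ c → toℚ c ℚ.* halfRatio l) count-orbit ⟩
      toℚ l ℚ.* halfRatio l               ≡⟨ toℚ-*-halfRatio l ⟩
      toℚ ⌊ l /2⌋                         ∎
      where
      open ≡-Reasoning
      L-orbit : ∀ x → T (orbit x) → L x ≡ l
      L-orbit x x∈ with i , _ , refl ← image-sound _ l x x∈ = L-σ^ i x₀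

    free-orbit-bound : ∀ B → Free B → count (B ∩ᵇ orbit) ≤ ⌊ l /2⌋
    free-orbit-bound B free = subst (count (B ∩ᵇ orbit) ≤_) (cong ⌊_/2⌋ (suc-pred l))
      (≤-trans (≤-reflexive (trans (count-∩-orbit B) (cong (λ k → ∑< k (λ i → [ b i ]ᵇ)) (sym (suc-pred l)))))
               (noTwoCyclicallyAdjacent-bound (pred l) b (λ i _ → free (σ^ i x₀)) wrap))
      where
      b : ℕ → Bool
      b i = B (σ^ i x₀)
      wrap : T (b (pred l)) → T (b 0) → ⊥
      wrap Bl-1 B0 = free (σ^ (pred l) x₀) Bl-1
        (subst (T ∘ B) (sym (trans (cong (λ k → σ^ k x₀) (suc-pred l)) σ^l)) B0)

    oddIterate : ℕ → Fin n
    oddIterate j = σ^ (suc (j * 2)) x₀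

    alternating : Fin n → Bool
    alternating = image oddIterate ⌊ l /2⌋

    alternating⊆orbit : alternating ⊆ᵇ orbit
    alternating⊆orbit x x∈ with j , j<l/2 , refl ← image-sound oddIterate ⌊ l /2⌋ x x∈ =
      image-complete (λ i → σ^ i x₀) (j<⌊l/2⌋⇒1+2j<l j<l/2)

    count-alternating : count alternating ≡ ⌊ l /2⌋
    count-alternating = trans (count-∩-image (λ _ → true) oddIterate ⌊ l /2⌋ oddIterate-injective) (∑<-ones _)
      where
      oddIterate-injective : InjectiveBelow ⌊ l /2⌋ oddIterate
      oddIterate-injective {i} {j} i<l/2 j<l/2 e = *-cancelʳ-≡ i j 2
        (suc-injective (orbit-injective (j<⌊l/2⌋⇒1+2j<l i<l/2) (j<⌊l/2⌋⇒1+2j<l j<l/2) e))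

    -- σ x is the even iterate of index 2j + 2, which can equal an odd one only by wrapping around to 0.
    alternating-free : Free alternating
    alternating-free x x∈ σx∈
      with image-sound oddIterate ⌊ l /2⌋ x x∈ | image-sound oddIterate ⌊ l /2⌋ (σ x) σx∈
    ... | j , j<l/2 , refl | j′ , j′<l/2 , e with m≤n⇒m<n∨m≡n (j<⌊l/2⌋⇒1+2j<l j<l/2)
    ...   | inj₁ 2j+2<l = odd≢even j′ (suc j) (orbit-injective (j<⌊l/2⌋⇒1+2j<l j′<l/2) 2j+2<l e)
    ...   | inj₂ 2j+2≡l = 0≢1+n (orbit-injective 1≤l (j<⌊l/2⌋⇒1+2j<l j′<l/2)
                            (trans (sym σ^l) (trans (cong (λ k → σ^ k x₀) (sym 2j+2≡l)) (sym e))))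

    module _ {P : Fin n → Bool} (P-inv : Invariant P) (Px₀ : T (P x₀)) where

      P─orbit : Fin n → Bool
      P─orbit = P ─ᵇ orbit

      P─orbit-invariant : Invariant P─orbit
      P─orbit-invariant x = cong₂ (λ p o → p ∧ not o) (P-inv x) (orbit-σ x)

      count-P : count P ≡ count P─orbit + l
      count-P = trans (ℕΣ.∑∈-─ _ (orbit⊆ P-inv Px₀)) (cong (λ k → count P─orbit + k) count-orbit)

      count-P─orbit< : count P─orbit < count P
      count-P─orbit< = begin-strict
        count P─orbit      <⟨ m<m+n (count P─orbit) 1≤l ⟩
        count P─orbit + l  ≡⟨ sym count-P ⟩
        count P            ∎
        where open ≤-Reasoning

      module _ {A′ : Fin n → Bool} (A′-free : Free A′) (A′⊆P─orbit : A′ ⊆ᵇ P─orbit) where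

        A′∩orbit≡∅ : Disjoint A′ orbit
        A′∩orbit≡∅ x A′x orbit-x = T-not (proj₂ (Equivalence.to Boolₚ.T-∧ (A′⊆P─orbit x A′x))) orbit-x

        count-∪-alternating : count (A′ ∪ᵇ alternating) ≡ count A′ + ⌊ l /2⌋
        count-∪-alternating = trans (ℕΣ.∑∈-∪ _ (λ x A′x alt-x → A′∩orbit≡∅ x A′x (alternating⊆orbit x alt-x)))
                                    (cong (λ c → count A′ + c) count-alternating)

        ∪-alternating⊆P : A′ ∪ᵇ alternating ⊆ᵇ P
        ∪-alternating⊆P x x∈ with Equivalence.to Boolₚ.T-∨ x∈
        ... | inj₁ A′x   = proj₁ (Equivalence.to Boolₚ.T-∧ (A′⊆P─orbit x A′x))
        ... | inj₂ alt-x = orbit⊆ P-inv Px₀ x (alternating⊆orbit x alt-x)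

        ∪-alternating-free : Free (A′ ∪ᵇ alternating)
        ∪-alternating-free x x∈ σx∈ with Equivalence.to Boolₚ.T-∨ x∈ | Equivalence.to Boolₚ.T-∨ σx∈
        ... | inj₁ A′x   | inj₁ A′σx   = A′-free x A′x A′σx
        ... | inj₁ A′x   | inj₂ alt-σx =
          A′∩orbit≡∅ x A′x (subst T (orbit-σ x) (alternating⊆orbit (σ x) alt-σx))
        ... | inj₂ alt-x | inj₁ A′σx   =
          A′∩orbit≡∅ (σ x) A′σx (subst T (sym (orbit-σ x)) (alternating⊆orbit x alt-x))
        ... | inj₂ alt-x | inj₂ alt-σx = alternating-free x alt-x alt-σx

      free-bound : ∀ {m′} → (∀ B → Free B → B ⊆ᵇ P─orbit → count B ≤ m′) →
                   ∀ B → Free B → B ⊆ᵇ P → count B ≤ m′ + ⌊ l /2⌋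
      free-bound {m′} bound′ B B-free B⊆P = begin
        count B                             ≡⟨ ℕΣ.∑∈-─ {C = B ∩ᵇ orbit} _ (λ x → proj₁ ∘ Equivalence.to Boolₚ.T-∧) ⟩
        count B─orbit + count (B ∩ᵇ orbit)  ≤⟨ +-mono-≤ (bound′ B─orbit B─orbit-free B─orbit⊆P─orbit)
                                                        (free-orbit-bound B B-free) ⟩
        m′ + ⌊ l /2⌋                        ∎
        where
        open ≤-Reasoning
        B─orbit : Fin n → Bool
        B─orbit = B ─ᵇ (B ∩ᵇ orbit)
        B─orbit-free : Free B─orbit
        B─orbit-free = Free-⊆ {B─orbit} (λ x → proj₁ ∘ Equivalence.to Boolₚ.T-∧) B-free
        B─orbit⊆P─orbit : B─orbit ⊆ᵇ P─orbit
        B─orbit⊆P─orbit x = lemma (B x) (orbit x) (P x) (B⊆P x)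
          where
          lemma : ∀ b o p → (T b → T p) → T (b ∧ not (b ∧ o)) → T (p ∧ not o)
          lemma true false true  _   _ = _
          lemma true false false b⇒p _ = b⇒p _

      weight-P : weight P ≡ weight P─orbit ℚ.+ toℚ ⌊ l /2⌋
      weight-P = trans (ℚΣ.∑∈-─ _ (orbit⊆ P-inv Px₀)) (cong (weight P─orbit ℚ.+_) weight-orbit)

      extend : HasMaxFree P─orbit → HasMaxFree P
      extend (m′ , ((A′ , A′-free , A′⊆ , count-A′) , bound′) , m′≡weight) =
        m′ + ⌊ l /2⌋ ,
        ((A′ ∪ᵇ alternating , ∪-alternating-free A′-free A′⊆ , ∪-alternating⊆P A′-free A′⊆ ,
          trans (count-∪-alternating A′-free A′⊆) (cong (_+ ⌊ l /2⌋) count-A′)) ,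
         free-bound bound′) ,
        trans (toℚ-+ m′ ⌊ l /2⌋) (trans (cong (ℚ._+ toℚ ⌊ l /2⌋) m′≡weight) (sym weight-P))

  maxFree-∅ : ∀ {P} → ¬ (Σ (Fin n) (T ∘ P)) → HasMaxFree P
  maxFree-∅ {P} P≡∅ =
    0 , (((λ _ → false) , (λ _ ()) , (λ _ ()) , ℕΣ.∑∈-∅ {n} (λ _ → 1) (λ _ → refl)) , bound) ,
    sym (ℚΣ.∑∈-∅ _ P≗false)
    where
    P≗false : ∀ x → P x ≡ false
    P≗false x = ¬T⇒≡false (λ Px → P≡∅ (x , Px))
    bound : ∀ B → Free B → B ⊆ᵇ P → count B ≤ 0
    bound B _ B⊆P = ≤-reflexive (ℕΣ.∑∈-∅ _ (λ x → ¬T⇒≡false (λ Bx → P≡∅ (x , B⊆P x Bx))))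

  maxFree-bounded : ∀ c P → Invariant P → count P ≤ c → HasMaxFree P
  maxFree-bounded c P P-inv count≤c with any? (λ x → T? (P x))
  ... | no P≡∅ = maxFree-∅ P≡∅
  ... | yes (x₀ , Px₀) with c | <-≤-trans (Orbit.count-P─orbit< x₀ P-inv Px₀) count≤c
  ...   | suc c′ | count<1+c′ = Orbit.extend x₀ P-inv Px₀
    (maxFree-bounded c′ _ (Orbit.P─orbit-invariant x₀ P-inv Px₀) (≤-pred count<1+c′))

  maxFree : ∀ P → Invariant P → HasMaxFree P
  maxFree P P-inv = maxFree-bounded (count P) P P-inv ≤-refl

-- Multiplication by k modulo N

%≡%⇒∣∸ : ∀ {b c} d .{{_ : NonZero d}} → b ≤ c → c % d ≡ b % d → d ∣ c ∸ b
%≡%⇒∣∸ {b} {c} d b≤c e = divides (c ℕ./ d ∸ b ℕ./ d) (begin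
  c ∸ b                                        ≡⟨ cong₂ _∸_ (m≡m%n+[m/n]*n c d) (m≡m%n+[m/n]*n b d) ⟩
  (c % d + c ℕ./ d * d) ∸ (b % d + b ℕ./ d * d)    ≡⟨ cong (λ r → (r + c ℕ./ d * d) ∸ (b % d + b ℕ./ d * d)) e ⟩
  (b % d + c ℕ./ d * d) ∸ (b % d + b ℕ./ d * d)    ≡⟨ [m+n]∸[m+o]≡n∸o (b % d) (c ℕ./ d * d) (b ℕ./ d * d) ⟩
  c ℕ./ d * d ∸ b ℕ./ d * d                        ≡⟨ sym (*-distribʳ-∸ d (c ℕ./ d) (b ℕ./ d)) ⟩
  (c ℕ./ d ∸ b ℕ./ d) * d                          ∎)
  where open ≡-Reasoning

∣∸⇒%≡% : ∀ {b c} d .{{_ : NonZero d}} → b ≤ c → d ∣ c ∸ b → c % d ≡ b % d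
∣∸⇒%≡% {b} {c} d b≤c (divides q e) = begin
  c % d                ≡⟨ cong (_% d) (sym (m+[n∸m]≡n b≤c)) ⟩
  (b + (c ∸ b)) % d    ≡⟨ cong (λ r → (b + r) % d) e ⟩
  (b + q * d) % d      ≡⟨ [m+kn]%n≡m%n b q d ⟩
  b % d                ∎
  where open ≡-Reasoning

∣∧<⇒≡0 : ∀ {m d} → d ∣ m → m < d → m ≡ 0
∣∧<⇒≡0 {zero}  _   _   = refl
∣∧<⇒≡0 {suc m} d∣m m<d = ⊥-elim (<⇒≱ m<d (∣⇒≤ d∣m))

additiveOrder : ℕ → ℕ → ℕ
additiveOrder n y = quotient (gcd[m,n]∣n y n)

additiveOrder-* : ∀ n y → n ≡ additiveOrder n y * gcd y n
additiveOrder-* n y = _∣_.equality (gcd[m,n]∣n y n)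

additiveOrder∣n : ∀ n y → additiveOrder n y ∣ n
additiveOrder∣n n y = divides (gcd y n) (trans (additiveOrder-* n y) (*-comm (additiveOrder n y) (gcd y n)))

additiveOrder-nonZero : ∀ n y .{{_ : NonZero n}} → NonZero (additiveOrder n y)
additiveOrder-nonZero n y = ≢-nonZero (λ d≡0 → ≢-nonZero⁻¹ n (trans (additiveOrder-* n y) (cong (_* gcd y n) d≡0)))

gcd-nonZero : ∀ n y .{{_ : NonZero n}} → NonZero (gcd y n)
gcd-nonZero n y = ≢-nonZero (λ g≡0 → ≢-nonZero⁻¹ n
  (trans (additiveOrder-* n y) (trans (cong (additiveOrder n y *_) g≡0) (*-zeroʳ (additiveOrder n y)))))

additiveOrder⊥quotient : ∀ n y .{{_ : NonZero n}} → Coprime (additiveOrder n y) (quotient (gcd[m,n]∣m y n))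
additiveOrder⊥quotient n y {e} (e∣d , e∣t) =
  ∣1⇒≡1 (*-cancelˡ-∣ g (subst (g * e ∣_) (sym (*-identityʳ g)) (subst (_∣ g) (*-comm e g) eg∣g)))
  where
  g : ℕ
  g = gcd y n
  instance
    g≢0 : NonZero g
    g≢0 = gcd-nonZero n y
  eg∣g : e * g ∣ g
  eg∣g = gcd-greatest (subst (e * g ∣_) (sym (_∣_.equality (gcd[m,n]∣m y n))) (*-monoˡ-∣ g e∣t))
                      (subst (e * g ∣_) (sym (additiveOrder-* n y)) (*-monoˡ-∣ g e∣d))

module MultiplicationModulo (N k : ℕ) {{_ : NonZero N}} {{_ : NonZero k}} (N⊥k : Coprime N k) where

  σ : Fin N → Fin N
  σ x = fromℕ< (m%n<n (k * toℕ x) N)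

  toℕ-σ : ∀ x → toℕ (σ x) ≡ k * toℕ x % N
  toℕ-σ x = toℕ-fromℕ< (m%n<n (k * toℕ x) N)

  private
    k*-%-cancel : ∀ {a b} → a ≤ b → b < N → k * a % N ≡ k * b % N → a ≡ b
    k*-%-cancel {a} {b} a≤b b<N e = ≤-antisym a≤b (m∸n≡0⇒m≤n (∣∧<⇒≡0 N∣b∸a (≤-<-trans (m∸n≤m b a) b<N)))
      where
      N∣b∸a : N ∣ b ∸ a
      N∣b∸a = coprime-divisor N⊥k (subst (N ∣_) (sym (*-distribˡ-∸ k b a)) (%≡%⇒∣∸ N (*-monoʳ-≤ k a≤b) (sym e)))

    σ≡⇒%≡ : ∀ {x y} → σ x ≡ σ y → k * toℕ x % N ≡ k * toℕ y % N
    σ≡⇒%≡ {x} {y} e = trans (sym (toℕ-σ x)) (trans (cong toℕ e) (toℕ-σ y))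

  σ-injective : ∀ {x y} → σ x ≡ σ y → x ≡ y
  σ-injective {x} {y} σx≡σy with ≤-total (toℕ x) (toℕ y)
  ... | inj₁ x≤y = toℕ-injective (k*-%-cancel x≤y (toℕ<n y) (σ≡⇒%≡ σx≡σy))
  ... | inj₂ y≤x = toℕ-injective (sym (k*-%-cancel y≤x (toℕ<n x) (σ≡⇒%≡ (sym σx≡σy))))

  open Orbits σ σ-injective public

  toℕ-σ^ : ∀ i x → toℕ (σ^ i x) ≡ k ^ i * toℕ x % N
  toℕ-σ^ zero    x = sym (trans (cong (_% N) (*-identityˡ (toℕ x))) (m<n⇒m%n≡m (toℕ<n x)))
  toℕ-σ^ (suc i) x = begin
    toℕ (σ (σ^ i x))                ≡⟨ toℕ-σ (σ^ i x) ⟩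
    k * toℕ (σ^ i x) % N            ≡⟨ cong (λ r → k * r % N) (toℕ-σ^ i x) ⟩
    k * (k ^ i * toℕ x % N) % N     ≡⟨ %-distribʳ-*-% k (k ^ i * toℕ x) ⟩
    k * (k ^ i * toℕ x) % N         ≡⟨ cong (_% N) (sym (*-assoc k (k ^ i) (toℕ x))) ⟩
    k ^ suc i * toℕ x % N           ∎
    where
    open ≡-Reasoning
    %-distribʳ-*-% : ∀ m n → m * (n % N) % N ≡ m * n % N
    %-distribʳ-*-% m n = begin
      m * (n % N) % N                ≡⟨ %-distribˡ-* m (n % N) N ⟩
      (m % N) * (n % N % N) % N      ≡⟨ cong (λ r → (m % N) * r % N) (m%n%n≡m%n n N) ⟩
      (m % N) * (n % N) % N          ≡⟨ sym (%-distribˡ-* m n N) ⟩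
      m * n % N                      ∎

  σ^≡id⇔additiveOrder∣ : ∀ i x → σ^ i x ≡ x ⇔ additiveOrder N (toℕ x) ∣ k ^ i ∸ 1
  σ^≡id⇔additiveOrder∣ i x = ⇔.trans (⇔.trans (⇔.trans step₁ step₂) step₃) step₄
    where
    a g t d : ℕ
    a = toℕ x
    g = gcd a N
    t = quotient (gcd[m,n]∣m a N)
    d = additiveOrder N a
    instance
      g≢0 : NonZero g
      g≢0 = gcd-nonZero N a
      kⁱ≢0 : NonZero (k ^ i)
      kⁱ≢0 = m^n≢0 k i
    a≤kⁱa : a ≤ k ^ i * a
    a≤kⁱa = m≤n*m a (k ^ i)
    N≡g*d : N ≡ g * d
    N≡g*d = trans (additiveOrder-* N a) (*-comm d g)
    kⁱa∸a≡ : k ^ i * a ∸ a ≡ g * ((k ^ i ∸ 1) * t)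
    kⁱa∸a≡ = begin
      k ^ i * a ∸ a                  ≡⟨ cong (k ^ i * a ∸_) (sym (*-identityˡ a)) ⟩
      k ^ i * a ∸ 1 * a              ≡⟨ sym (*-distribʳ-∸ a (k ^ i) 1) ⟩
      (k ^ i ∸ 1) * a                ≡⟨ cong ((k ^ i ∸ 1) *_) (_∣_.equality (gcd[m,n]∣m a N)) ⟩
      (k ^ i ∸ 1) * (t * g)          ≡⟨ lemma (k ^ i ∸ 1) t g ⟩
      g * ((k ^ i ∸ 1) * t)          ∎
      where
      open ≡-Reasoning
      lemma : ∀ u v w → u * (v * w) ≡ w * (u * v)
      lemma = solve-∀
    step₁ : σ^ i x ≡ x ⇔ k ^ i * a % N ≡ a % N
    step₁ = mk⇔ (λ e → trans (sym (toℕ-σ^ i x)) (trans (cong toℕ e) (sym (m<n⇒m%n≡m (toℕ<n x)))))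
                (λ e → toℕ-injective (trans (toℕ-σ^ i x) (trans e (m<n⇒m%n≡m (toℕ<n x)))))
    step₂ : k ^ i * a % N ≡ a % N ⇔ N ∣ k ^ i * a ∸ a
    step₂ = mk⇔ (%≡%⇒∣∸ N a≤kⁱa) (∣∸⇒%≡% N a≤kⁱa)
    step₃ : N ∣ k ^ i * a ∸ a ⇔ d ∣ (k ^ i ∸ 1) * t
    step₃ = mk⇔ (λ N∣ → *-cancelˡ-∣ g (subst₂ _∣_ N≡g*d kⁱa∸a≡ N∣))
                (λ d∣ → subst₂ _∣_ (sym N≡g*d) (sym kⁱa∸a≡) (*-monoʳ-∣ g d∣))
    step₄ : d ∣ (k ^ i ∸ 1) * t ⇔ d ∣ k ^ i ∸ 1
    step₄ = mk⇔ (λ d∣ → coprime-divisor (additiveOrder⊥quotient N a) (subst (d ∣_) (*-comm (k ^ i ∸ 1) t) d∣))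
                (∣m⇒∣m*n t)

gcd[n,n]≡n : ∀ n → gcd n n ≡ n
gcd[n,n]≡n n = ∣-antisym (gcd[m,n]∣m n n) (gcd-greatest ∣-refl ∣-refl)

gcd[1%n,n]≡1 : ∀ n .{{_ : NonZero n}} → gcd (1 % n) n ≡ 1
gcd[1%n,n]≡1 (suc zero)    = refl
gcd[1%n,n]≡1 (suc (suc n)) = gcd-zeroˡ (suc (suc n))

k^p≡1-mod : ∀ d k {{_ : NonZero d}} {{_ : NonZero k}} → Coprime d k →
            Σ ℕ λ p → 1 ≤ p × p ≤ d × d ∣ k ^ p ∸ 1
k^p≡1-mod d k d⊥k = returns (σ^-returns one)
  where
  open MultiplicationModulo d k d⊥k
  one : Fin d
  one = fromℕ< (m%n<n 1 d)
  additiveOrder[1]≡d : additiveOrder d (toℕ one) ≡ d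
  returns : (Σ ℕ λ p → 1 ≤ p × p ≤ d × σ^ p one ≡ one) → Σ ℕ λ p → 1 ≤ p × p ≤ d × d ∣ k ^ p ∸ 1
  returns (p , 1≤p , p≤d , σ^p1≡1) =
    p , 1≤p , p≤d ,
    subst (_∣ k ^ p ∸ 1) additiveOrder[1]≡d (Equivalence.to (σ^≡id⇔additiveOrder∣ p one) σ^p1≡1)
  additiveOrder[1]≡d = sym (begin
    d                                                    ≡⟨ additiveOrder-* d (toℕ one) ⟩
    additiveOrder d (toℕ one) * gcd (toℕ one) d          ≡⟨ cong (λ r → additiveOrder d (toℕ one) * gcd r d)
                                                                 (toℕ-fromℕ< (m%n<n 1 d)) ⟩
    additiveOrder d (toℕ one) * gcd (1 % d) d            ≡⟨ cong (additiveOrder d (toℕ one) *_) (gcd[1%n,n]≡1 d) ⟩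
    additiveOrder d (toℕ one) * 1                        ≡⟨ *-identityʳ _ ⟩
    additiveOrder d (toℕ one)                            ∎)
    where open ≡-Reasoning

module _ (k d : ℕ) where

  private
    Returns : ℕ → Set
    Returns i = d ∣ k ^ suc i ∸ 1

  ordSearch-spec : ∀ fuel i → (Σ ℕ λ j → i ≤ j × j < fuel + i × Returns j) →
    Returns (ordSearch k d fuel i) × (∀ j → i ≤ j → j < ordSearch k d fuel i → ¬ Returns j)
  ordSearch-spec zero i (j , i≤j , j<i , _) = ⊥-elim (<⇒≱ j<i i≤j)
  ordSearch-spec (suc fuel) i (j , i≤j , j<fuel+i , ret-j) with d ∣? (k ^ suc i ∸ 1)
  ... | yes ret-i = ret-i , λ j′ i≤j′ j′<i → ⊥-elim (<⇒≱ j′<i i≤j′)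
  ... | no ¬ret-i with m≤n⇒m<n∨m≡n i≤j
  ...   | inj₂ refl = ⊥-elim (¬ret-i ret-j)
  ...   | inj₁ i<j with ordSearch-spec fuel (suc i) (j , i<j , subst (j <_) (sym (+-suc fuel i)) j<fuel+i , ret-j)
  ...     | ret , least = ret , least′
    where
    least′ : ∀ j′ → i ≤ j′ → j′ < ordSearch k d fuel (suc i) → ¬ Returns j′
    least′ j′ i≤j′ j′<r with m≤n⇒m<n∨m≡n i≤j′
    ... | inj₂ refl = ¬ret-i
    ... | inj₁ i<j′ = least j′ i<j′ j′<r

  ord-spec : (Σ ℕ λ p → 1 ≤ p × p ≤ d × d ∣ k ^ p ∸ 1) →
    d ∣ k ^ ord k d ∸ 1 × (∀ i → 1 ≤ i → i < ord k d → ¬ (d ∣ k ^ i ∸ 1))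
  ord-spec (suc p , _ , p≤d , ret) with ordSearch-spec d 0 (p , z≤n , subst (p <_) (sym (+-identityʳ d)) p≤d , ret)
  ... | ret-ord , least = ret-ord , λ { (suc i) _ i<ord → least i z≤n (≤-pred i<ord) }

ord[k,1]≡1 : ∀ k → ord k 1 ≡ 1
ord[k,1]≡1 k with 1 ∣? (k ^ 1 ∸ 1)
... | yes _   = refl
... | no  1∤_ = ⊥-elim (1∤_ (1∣ _))

module _ (N k : ℕ) {{_ : NonZero N}} {{_ : NonZero k}} (N⊥k : Coprime N k) where
  open MultiplicationModulo N k N⊥k

  ord-isPeriod : ∀ x → IsPeriod x (ord k (additiveOrder N (toℕ x)))
  ord-isPeriod x = fromOrdSpec (ord-spec k d (k^p≡1-mod d k d⊥k))
    where
    d : ℕ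
    d = additiveOrder N (toℕ x)
    instance
      d≢0 : NonZero d
      d≢0 = additiveOrder-nonZero N (toℕ x)
    d⊥k : Coprime d k
    d⊥k (e∣d , e∣k) = N⊥k (∣-trans e∣d (additiveOrder∣n N (toℕ x)) , e∣k)
    fromOrdSpec : d ∣ k ^ ord k d ∸ 1 × (∀ i → 1 ≤ i → i < ord k d → ¬ (d ∣ k ^ i ∸ 1)) →
                  IsPeriod x (ord k d)
    fromOrdSpec (d∣kᵒ∸1 , least) =
      s≤s z≤n , Equivalence.from (σ^≡id⇔additiveOrder∣ (ord k d) x) d∣kᵒ∸1 ,
      λ i 1≤i i<ord σ^ix≡x → least i 1≤i i<ord (Equivalence.to (σ^≡id⇔additiveOrder∣ i x) σ^ix≡x)

-- Sums over the divisors of n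

module _ {P : ℕ → Set} (P? : ∀ x → Dec (P x)) where

  length-filter-applyUpTo : ∀ h m → length (filter P? (applyUpTo h m)) ≡ ∑< m (λ i → [ does (P? (h i)) ]ᵇ)
  length-filter-applyUpTo h zero = refl
  length-filter-applyUpTo h (suc m) with does (P? (h 0))
  ... | true  = cong suc (length-filter-applyUpTo (h ∘ suc) m)
  ... | false = length-filter-applyUpTo (h ∘ suc) m

  sumℚ-filter-applyUpTo : ∀ (F : ℕ → ℚ) h m →
    sumℚ (map F (filter P? (applyUpTo h m))) ≡ ℚΣ.∑< m (λ i → if does (P? (h i)) then F (h i) else 0ℚ)
  sumℚ-filter-applyUpTo F h zero = refl
  sumℚ-filter-applyUpTo F h (suc m) with does (P? (h 0))
  ... | true  = cong (F (h 0) ℚ.+_) (sumℚ-filter-applyUpTo F (h ∘ suc) m)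
  ... | false = trans (sumℚ-filter-applyUpTo F (h ∘ suc) m) (sym (ℚₚ.+-identityˡ _))

φ≡∑<-coprime : ∀ d → φ d ≡ ∑< d (λ t → [ does (gcd t d ≟ 1) ]ᵇ)
φ≡∑<-coprime d = begin
  φ d                                                  ≡⟨ cong (length ∘ filter (λ t → coprime? t d)) (map-upTo suc d) ⟩
  length (filter (λ t → coprime? t d) (applyUpTo suc d)) ≡⟨ length-filter-applyUpTo (λ t → coprime? t d) suc d ⟩
  ∑< d (λ t → coprime (suc t))                         ≡⟨ +-cancelˡ-≡ (coprime 0) _ _ shift ⟩
  ∑< d coprime                                         ∎
  where
  open ≡-Reasoning
  coprime : ℕ → ℕ
  coprime t = [ does (gcd t d ≟ 1) ]ᵇ
  -- gcd 0 d = d = gcd d d, so the range {1, …, d} may be replaced by {0, …, d - 1}.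
  coprime0≡coprimed : coprime 0 ≡ coprime d
  coprime0≡coprimed = cong (λ r → [ does (r ≟ 1) ]ᵇ) (trans (gcd-identityˡ d) (sym (gcd[n,n]≡n d)))
  shift : coprime 0 + ∑< d (λ t → coprime (suc t)) ≡ coprime 0 + ∑< d coprime
  shift = begin
    ∑< (suc d) coprime         ≡⟨ ∑<-last d coprime ⟩
    ∑< d coprime + coprime d   ≡⟨ +-comm _ (coprime d) ⟩
    coprime d + ∑< d coprime   ≡⟨ cong (_+ ∑< d coprime) (sym coprime0≡coprimed) ⟩
    coprime 0 + ∑< d coprime   ∎

count-additiveOrder : ∀ n d .{{_ : NonZero n}} → d ∣ n →
                      ∑< n (λ y → [ does (additiveOrder n y ≟ d) ]ᵇ) ≡ φ d
count-additiveOrder n d (divides zero n≡0) = ⊥-elim (≢-nonZero⁻¹ n n≡0)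
count-additiveOrder n d (divides g@(suc g′) n≡g*d) = begin
  ∑< n (λ y → [ does (additiveOrder n y ≟ d) ]ᵇ)       ≡⟨ ∑<-cong n (λ y _ → cong [_]ᵇ (additiveOrder≡d⇔ y)) ⟩
  ∑< n hasGcd-g                                        ≡⟨ cong (λ m → ∑< m hasGcd-g) (trans n≡g*d (*-comm g d)) ⟩
  ∑< (d * g) hasGcd-g                                  ≡⟨ ∑<-* d g hasGcd-g ⟩
  ∑< d (λ t → ∑< g (λ r → hasGcd-g (t * g + r)))       ≡⟨ ∑<-cong d (λ t _ → block t) ⟩
  ∑< d (λ t → [ does (gcd t d ≟ 1) ]ᵇ)                 ≡⟨ sym (φ≡∑<-coprime d) ⟩
  φ d                                                  ∎
  where
  open ≡-Reasoning
  n≡d*g : n ≡ d * g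
  n≡d*g = trans n≡g*d (*-comm g d)
  instance
    d≢0 : NonZero d
    d≢0 = ≢-nonZero (λ d≡0 → ≢-nonZero⁻¹ n (trans n≡d*g (cong (_* g) d≡0)))
  hasGcd-g : ℕ → ℕ
  hasGcd-g y = [ does (gcd y n ≟ g) ]ᵇ
  additiveOrder≡d⇔ : ∀ y → does (additiveOrder n y ≟ d) ≡ does (gcd y n ≟ g)
  additiveOrder≡d⇔ y = does-⇔ (mk⇔
    (λ e → *-cancelˡ-≡ (gcd y n) g d (trans (sym (trans (additiveOrder-* n y) (cong (_* gcd y n) e))) n≡d*g))
    (λ e → *-cancelʳ-≡ (additiveOrder n y) d g
             (trans (sym (trans (additiveOrder-* n y) (cong (additiveOrder n y *_) e))) n≡d*g)))
    (additiveOrder n y ≟ d) (gcd y n ≟ g)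
  -- Writing y = t g + r with r < g: gcd y n = g forces r = 0, and then gcd (t g) (d g) = g · gcd t d.
  block : ∀ t → ∑< g (λ r → hasGcd-g (t * g + r)) ≡ [ does (gcd t d ≟ 1) ]ᵇ
  block t = trans (cong₂ _+_ r≡0 (trans (∑<-cong g′ r≢0) (ℕΣ.sum-replicate-zero g′))) (+-identityʳ _)
    where
    gcd[tg,n] : gcd (t * g + 0) n ≡ g * gcd t d
    gcd[tg,n] = trans (cong₂ gcd (trans (+-identityʳ _) (*-comm t g)) (trans n≡g*d refl))
                      (sym (c*gcd[m,n]≡gcd[cm,cn] g t d))
    r≡0 : hasGcd-g (t * g + 0) ≡ [ does (gcd t d ≟ 1) ]ᵇ
    r≡0 = cong [_]ᵇ (trans (cong (λ r → does (r ≟ g)) gcd[tg,n]) (does-⇔ (mk⇔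
      (λ e → *-cancelˡ-≡ (gcd t d) 1 g (trans e (sym (*-identityʳ g))))
      (λ e → trans (cong (g *_) e) (*-identityʳ g))) (g * gcd t d ≟ g) (gcd t d ≟ 1)))
    r≢0 : ∀ r → r < g′ → hasGcd-g (t * g + suc r) ≡ 0
    r≢0 r r<g′ = cong [_]ᵇ (dec-false (gcd (t * g + suc r) n ≟ g) λ e →
      1+n≢0 (∣∧<⇒≡0 (∣m+n∣m⇒∣n (subst (_∣ t * g + suc r) e (gcd[m,n]∣m _ n)) (n∣m*n t)) (s≤s r<g′)))

∑<-δ : ∀ n j (G : ℕ → ℚ) → j < n → ℚΣ.∑< n (λ e → if does (j ≟ e) then G e else 0ℚ) ≡ G j
∑<-δ (suc n) zero    G _         = trans (cong (G 0 ℚ.+_) (ℚΣ.sum-replicate-zero n)) (ℚₚ.+-identityʳ (G 0))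
∑<-δ (suc n) (suc j) G (s≤s j<n) = trans (ℚₚ.+-identityˡ _) (∑<-δ n j (G ∘ suc) j<n)

∑<-fibres : ∀ n (h : ℕ → ℕ) (G : ℕ → ℚ) → (∀ y → y < n → 1 ≤ h y × h y ≤ n) →
  ℚΣ.∑< n (G ∘ h) ≡ ℚΣ.∑< n (λ e → toℚ (∑< n (λ y → [ does (h y ≟ suc e) ]ᵇ)) ℚ.* G (suc e))
∑<-fibres n h G h-bounded = begin
  ℚΣ.∑< n (G ∘ h)                           ≡⟨ ℚΣ.∑<-cong n (λ y y<n → sym (δ (h y) (h-bounded y y<n))) ⟩
  ℚΣ.∑< n (λ y → ℚΣ.∑< n (K y))             ≡⟨ ℚΣ.∑-comm {n} {n} (λ y e → K (toℕ y) (toℕ e)) ⟩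
  ℚΣ.∑< n (λ e → ℚΣ.∑< n (λ y → K y e))     ≡⟨ ℚΣ.∑<-cong n {λ e → ℚΣ.∑< n (λ y → K y e)}
                                                  (λ e _ → ∑∈-const {n} (λ y → does (h (toℕ y) ≟ suc e)) (G (suc e))) ⟩
  ℚΣ.∑< n (λ e → toℚ (∑< n (λ y → [ does (h y ≟ suc e) ]ᵇ)) ℚ.* G (suc e)) ∎
  where
  open ≡-Reasoning
  K : ℕ → ℕ → ℚ
  K y e = if does (h y ≟ suc e) then G (suc e) else 0ℚ
  δ : ∀ v → 1 ≤ v × v ≤ n → ℚΣ.∑< n (λ e → if does (v ≟ suc e) then G (suc e) else 0ℚ) ≡ G v
  δ (suc j) (_ , j<n) = ∑<-δ n j (G ∘ suc) j<n

∑<-additiveOrder : ∀ n .{{_ : NonZero n}} (G : ℕ → ℚ) →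
  ℚΣ.∑< n (G ∘ additiveOrder n) ≡ ℚΣ.∑< n (λ e → if does (suc e ∣? n) then toℚ (φ (suc e)) ℚ.* G (suc e) else 0ℚ)
∑<-additiveOrder n G =
  trans (∑<-fibres n (additiveOrder n) G bounded) (ℚΣ.∑<-cong n (λ e _ → fibre e (suc e ∣? n)))
  where
  bounded : ∀ y → y < n → 1 ≤ additiveOrder n y × additiveOrder n y ≤ n
  bounded y _ = >-nonZero⁻¹ _ {{additiveOrder-nonZero n y}} , ∣⇒≤ (additiveOrder∣n n y)
  fibre : ∀ e (e+1∣?n : Dec (suc e ∣ n)) → toℚ (∑< n (λ y → [ does (additiveOrder n y ≟ suc e) ]ᵇ)) ℚ.* G (suc e)
                                        ≡ (if does e+1∣?n then toℚ (φ (suc e)) ℚ.* G (suc e) else 0ℚ)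
  fibre e (yes e+1∣n) = cong (λ c → toℚ c ℚ.* G (suc e)) (count-additiveOrder n (suc e) e+1∣n)
  fibre e (no  e+1∤n) = trans (cong (λ c → toℚ c ℚ.* G (suc e)) none) (ℚₚ.*-zeroˡ (G (suc e)))
    where
    none : ∑< n (λ y → [ does (additiveOrder n y ≟ suc e) ]ᵇ) ≡ 0
    none = trans (∑<-cong n (λ y _ → cong [_]ᵇ (dec-false (additiveOrder n y ≟ suc e)
                   (λ eq → e+1∤n (subst (_∣ n) eq (additiveOrder∣n n y))))))
                 (ℕΣ.sum-replicate-zero n)

halfRatioSum : ℕ → ℕ → ℚ
halfRatioSum k n = ℚΣ.∑< n (λ y → halfRatio (ord k (additiveOrder n y)))

deficit : ℕ → ℕ → ℚ
deficit k d = + I (ord k d) / (2 * ord k d)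

halfRatio-+-deficit : ∀ k d → halfRatio (ord k d) ℚ.+ deficit k d ≡ ½
halfRatio-+-deficit k d = h/o+i/2o≡½ ⌊ ord k d /2⌋ (I (ord k d)) (ordPred k d) (⌊n/2⌋*2+n%2≡n (ord k d))

halfRatioSum-+-deficits : ∀ k n → halfRatioSum k n ℚ.+ ℚΣ.∑< n (deficit k ∘ additiveOrder n) ≡ toℚ n ℚ.* ½
halfRatioSum-+-deficits k n = begin
  halfRatioSum k n ℚ.+ ℚΣ.∑< n (deficit k ∘ additiveOrder n)
    ≡⟨ sym (ℚΣ.∑-distrib-+ {n} (λ y → halfRatio (ord k (d (toℕ y)))) (λ y → deficit k (d (toℕ y)))) ⟩
  ℚΣ.∑< n (λ y → halfRatio (ord k (d y)) ℚ.+ deficit k (d y))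
    ≡⟨ ℚΣ.∑<-cong n (λ y _ → halfRatio-+-deficit k (d y)) ⟩
  ℚΣ.∑< n (λ _ → ½)            ≡⟨ ∑∈-const {n} (λ _ → true) ½ ⟩
  toℚ (∑< n (λ _ → 1)) ℚ.* ½   ≡⟨ cong (λ c → toℚ c ℚ.* ½) (∑<-ones n) ⟩
  toℚ n ℚ.* ½                  ∎
  where
  open ≡-Reasoning
  d : ℕ → ℕ
  d = additiveOrder n

deficits≡½+∑divisorsNot1 : ∀ n′ k →
  ℚΣ.∑< (suc n′) (deficit k ∘ additiveOrder (suc n′)) ≡ ½ ℚ.+ sumℚ (map (term k) (divisorsNot1 (suc n′)))
deficits≡½+∑divisorsNot1 n′ k = trans (∑<-additiveOrder n (deficit k)) (cong₂ ℚ._+_ divisor-1 divisors≥2)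
  where
  open ≡-Reasoning
  n : ℕ
  n = suc n′
  divisorTerm : ℕ → ℚ
  divisorTerm d = if does (d ∣? n) then toℚ (φ d) ℚ.* deficit k d else 0ℚ
  divisor-1 : divisorTerm 1 ≡ ½
  divisor-1 = begin
    divisorTerm 1                             ≡⟨ cong (λ b → if b then toℚ (φ 1) ℚ.* deficit k 1 else 0ℚ)
                                                      (dec-true (1 ∣? n) (1∣ n)) ⟩
    toℚ 1 ℚ.* deficit k 1                     ≡⟨ ℚₚ.*-identityˡ (deficit k 1) ⟩
    + I (ord k 1) / (2 * suc (ordPred k 1))   ≡⟨ cong (λ o → + I (suc o) / (2 * suc o)) (suc-injective (ord[k,1]≡1 k)) ⟩
    ½                                         ∎
  divisors≥2 : ℚΣ.∑< n′ (λ e → divisorTerm (2 + e)) ≡ sumℚ (map (term k) (divisorsNot1 n))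
  divisors≥2 = sym (begin
    sumℚ (map (term k) (filter (_∣? n) (map (λ i → 2 + i) (upTo n′))))
      ≡⟨ cong (λ ds → sumℚ (map (term k) (filter (_∣? n) ds))) (map-upTo (λ i → 2 + i) n′) ⟩
    sumℚ (map (term k) (filter (_∣? n) (applyUpTo (λ i → 2 + i) n′)))
      ≡⟨ sumℚ-filter-applyUpTo (_∣? n) (term k) (λ i → 2 + i) n′ ⟩
    ℚΣ.∑< n′ (λ e → if does ((2 + e) ∣? n) then term k (2 + e) else 0ℚ)
      ≡⟨ ℚΣ.∑<-cong n′ (λ e _ → cong (λ q → if does ((2 + e) ∣? n) then q else 0ℚ)
                                      (/-*-numerator (φ (2 + e)) (I (ord k (2 + e))) (2 * ord k (2 + e)))) ⟩
    ℚΣ.∑< n′ (λ e → divisorTerm (2 + e))     ∎)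

halfRatioSum≡formula : ∀ n′ k → halfRatioSum k (suc n′) ≡ formula k (suc n′)
halfRatioSum≡formula n′ k = p+[q+r]≡s+q⇒p≡s-r {q = ½} {s = + n′ / 2} (begin
  halfRatioSum k n ℚ.+ (½ ℚ.+ S)
    ≡⟨ cong (halfRatioSum k n ℚ.+_) (sym (deficits≡½+∑divisorsNot1 n′ k)) ⟩
  halfRatioSum k n ℚ.+ ℚΣ.∑< n (deficit k ∘ additiveOrder n) ≡⟨ halfRatioSum-+-deficits k n ⟩
  toℚ n ℚ.* ½                                             ≡⟨ sym (n/2+½≡[1+n]*½ n′) ⟩
  + n′ / 2 ℚ.+ ½                                          ∎)
  where
  open ≡-Reasoning
  n : ℕ
  n = suc n′
  S : ℚ
  S = sumℚ (map (term k) (divisorsNot1 n))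

∣∣≡count-lookup : ∀ {n} (B : Subset n) → Subset.∣ B ∣ ≡ count (lookup B)
∣∣≡count-lookup []          = refl
∣∣≡count-lookup (true ∷ B)  = cong suc (∣∣≡count-lookup B)
∣∣≡count-lookup (false ∷ B) = ∣∣≡count-lookup B

∈⇒T-lookup : ∀ {n} {x : Fin n} {B : Subset n} → x ∈ B → T (lookup B x)
∈⇒T-lookup x∈B = Equivalence.from Boolₚ.T-≡ ([]=⇒lookup x∈B)

T-lookup⇒∈ : ∀ {n} {x : Fin n} {B : Subset n} → T (lookup B x) → x ∈ B
T-lookup⇒∈ {x = x} {B} t = lookup⇒[]= x B (Equivalence.to Boolₚ.T-≡ t)

module _ (n k : ℕ) {{_ : NonZero n}} {{_ : NonZero k}} (n⊥k : Coprime n k) where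
  open MultiplicationModulo n k n⊥k using (σ; σ-injective; toℕ-σ)
  open MaxFreeSets σ σ-injective (λ x → ord k (additiveOrder n (toℕ x))) (ord-isPeriod n k n⊥k)

  MulIs⇒≡σ : ∀ x y → MulIs n k x y → y ≡ σ x
  MulIs⇒≡σ x y (q , kx≡y+qn) = toℕ-injective (sym (begin
    toℕ (σ x)             ≡⟨ toℕ-σ x ⟩
    k * toℕ x % n         ≡⟨ cong (_% n) kx≡y+qn ⟩
    (toℕ y + q * n) % n   ≡⟨ [m+kn]%n≡m%n (toℕ y) q n ⟩
    toℕ y % n             ≡⟨ m<n⇒m%n≡m (toℕ<n y) ⟩
    toℕ y                 ∎))
    where open ≡-Reasoning

  MulIs-σ : ∀ x → MulIs n k x (σ x)
  MulIs-σ x = k * toℕ x ℕ./ n ,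
    trans (m≡m%n+[m/n]*n (k * toℕ x) n) (cong (_+ (k * toℕ x ℕ./ n) * n) (sym (toℕ-σ x)))

  IsMaxFree⇒IsRk : ∀ {m} → IsMaxFree (λ _ → true) m → IsRk k n m
  IsMaxFree⇒IsRk {m} ((A , A-free , _ , count-A) , bound) = (tabulate A , A-kfree , ∣A∣≡m) , B-bound
    where
    T-A : ∀ {x} → x ∈ tabulate A → T (A x)
    T-A {x} x∈A = subst T (lookup∘tabulate A x) (∈⇒T-lookup x∈A)
    A-kfree : KFree n k (tabulate A)
    A-kfree x y x∈A kx≡y y∈A = A-free x (T-A x∈A) (subst (T ∘ A) (MulIs⇒≡σ x y kx≡y) (T-A y∈A))
    ∣A∣≡m : Subset.∣ tabulate A ∣ ≡ m
    ∣A∣≡m = trans (∣∣≡count-lookup (tabulate A)) (trans (ℕΣ.∑∈-cong _ (lookup∘tabulate A)) count-A)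
    B-bound : ∀ B → KFree n k B → Subset.∣ B ∣ ≤ m
    B-bound B B-kfree = subst (_≤ m) (sym (∣∣≡count-lookup B)) (bound (lookup B) B-free (λ _ _ → _))
      where
      B-free : Free (lookup B)
      B-free x Bx Bσx = B-kfree x (σ x) (T-lookup⇒∈ Bx) (MulIs-σ x) (T-lookup⇒∈ Bσx)

  IsRk-halfRatioSum : Σ ℕ λ m → IsRk k n m × toℚ m ≡ halfRatioSum k n
  IsRk-halfRatioSum =
    let m , isMaxFree , m≡weight = maxFree (λ _ → true) (λ _ → refl)
    in m , IsMaxFree⇒IsRk isMaxFree , m≡weight

theorem1 : (n k : ℕ) → 1 ≤ n → 1 ≤ k → gcd n k ≡ 1 →
    Σ ℕ λ m → IsRk k n m × (+ m / 1 ≡ formula k n)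
theorem1 (suc n′) (suc k′) _ _ gcd≡1 =
  let m , isRk , m≡∑ = IsRk-halfRatioSum (suc n′) (suc k′) (gcd≡1⇒coprime gcd≡1)
  in m , isRk , trans m≡∑ (halfRatioSum≡formula n′ (suc k′))
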